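{- Let $\mathcal{P}$ be a profile of unrooted phylogenetic trees whose display graph $G(\mathcal{P})$ is connected. If $F$ is a minimal separator of $LG(\mathcal{P})$, then $LG(\mathcal{P})-F$ has exactly two connected components.
   Context: A phylogenetic tree is an unrooted tree whose leaves are bijectively labelled by a finite label set; leaves are identified with labels. A profile is a finite collection $\mathcal{P}=\{T_1,\dots,T_k\}$ of phylogenetic trees with pairwise disjoint sets of internal vertices. The display graph $G(\mathcal{P})$ has vertex set $\bigcup_iV(T_i)$ and edge set $\bigcup_iE(T_i)$. $LG(\mathcal{P})$ is the line graph of $G(\mathcal{P})$: vertex set $E(G(\mathcal{P}))$, two vertices adjacent iff the edges share an endpoint. In a graph $G$, for nonadjacent $a,b$, an $a$-$b$ separator is $U\subset V(G)$ with $a,b$ in different components of $G-U$; minimal if no proper subset is an $a$-$b$ separator; $U$ is a minimal separator if it is a minimal $a$-$b$ separator for some nonadjacent $a,b$. -}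

module Defs where

open import Data.Nat using (ℕ; _≤_)
open import Data.Fin using (Fin) renaming (_<_ to _<ᶠ_)
open import Data.Bool using (Bool; T)
open import Data.Unit using (⊤)
open import Data.Product using (Σ; ∃; ∃₂; _×_; _,_; proj₁; proj₂)
open import Data.Sum using (_⊎_)
open import Data.List using (List; []; _∷_; _++_; length; allFin)
open import Data.Bool.ListAction using (any)
open import Data.List.Relation.Unary.Linked using (Linked)
open import Data.List.Relation.Unary.Unique.Propositional using (Unique)
open import Relation.Nullary using (¬_)
open import Relation.Binary.PropositionalEquality using (_≡_; _≢_)

data Walk {V : Set} (Adj : V → V → Set) (P : V → Set) : V → V → Set where
  stop : ∀ {v} → P v → Walk Adj P v v
  step : ∀ {u v w} → P u → Adj u v → Walk Adj P v w → Walk Adj P u w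

record Cycle {V : Set} (Adj : V → V → Set) : Set where
  field
    first    : V
    rest     : List V
    long     : 2 ≤ length rest
    distinct : Unique (first ∷ rest)
    closed   : Linked Adj (first ∷ rest ++ first ∷ [])

record IsTree {V : Set} (P : V → Set) (Adj : V → V → Set) : Set where
  field
    edgesInside : ∀ u v → Adj u v → P u × P v
    symmetric   : ∀ u v → Adj u v → Adj v u
    irreflexive : ∀ v → ¬ Adj v v
    nonempty    : ∃ λ v → P v
    connected   : ∀ u v → P u → P v → Walk Adj P u v
    acyclic     : ¬ Cycle Adj

-- A leaf of a tree: a vertex of degree at most one
-- (degree 0 only occurs for the one-vertex tree).
IsLeaf : {V : Set} (P : V → Set) (Adj : V → V → Set) → V → Set
IsLeaf P Adj v = P v × (∀ u w → Adj v u → Adj v w → u ≡ w)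

-- All vertices of the display graph live in Fin N.  The
-- labels are the vertices with `label v ≡ true`; a leaf of every tree is
-- identified with its label, so leaves of different trees carrying the
-- same label are the same vertex.

record Profile (N k : ℕ) : Set where
  field
    label  : Fin N → Bool
    inT    : Fin k → Fin N → Bool
    adj    : Fin k → Fin N → Fin N → Bool
    isTree : ∀ i → IsTree (λ v → T (inT i v)) (λ u v → T (adj i u v))
    leaf⇒label : ∀ i v → IsLeaf (λ w → T (inT i w)) (λ u w → T (adj i u w)) v
                 → T (label v)
    label⇒leaf : ∀ i v → T (inT i v) → T (label v)
                 → IsLeaf (λ w → T (inT i w)) (λ u w → T (adj i u w)) v
    internalDisjoint : ∀ i j v → T (inT i v) → T (inT j v) → ¬ T (label v)
                       → i ≡ j
    covers : ∀ v → ∃ λ i → T (inT i v)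

module _ {N k : ℕ} (𝒫 : Profile N k) where
  open Profile 𝒫

  gadj : Fin N → Fin N → Bool
  gadj u v = any (λ i → adj i u v) (allFin k)

  DisplayAdj : Fin N → Fin N → Set
  DisplayAdj u v = T (gadj u v)

  -- edges of G(𝒫), as unordered pairs {u,v} represented with u < v
  record Edge : Set where
    constructor edge
    field
      lo   : Fin N
      hi   : Fin N
      lo<hi : lo <ᶠ hi
      isEdge : T (gadj lo hi)
  open Edge public

  LGAdj : Edge → Edge → Set
  LGAdj e f = ¬ (lo e ≡ lo f × hi e ≡ hi f)
            × (lo e ≡ lo f ⊎ lo e ≡ hi f ⊎ hi e ≡ lo f ⊎ hi e ≡ hi f)

Connected : {V : Set} → (V → V → Set) → Set
Connected {V} Adj = ∀ (u v : V) → Walk Adj (λ _ → ⊤) u v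

Separates : {W : Set} → (W → W → Set) → (W → Bool) → W → W → Set
Separates Adj U a b =
  ¬ T (U a) × ¬ T (U b) × ¬ Walk Adj (λ w → ¬ T (U w)) a b

MinimalSeparatorFor : {W : Set} → (W → W → Set) → (W → Bool) → W → W → Set
MinimalSeparatorFor {W} Adj U a b =
  Separates Adj U a b ×
  (∀ (U' : W → Bool) → (∀ w → T (U' w) → T (U w))
     → (∃ λ w → T (U w) × ¬ T (U' w)) → ¬ Separates Adj U' a b)

IsMinimalSeparator : {W : Set} → (W → W → Set) → (W → Bool) → Set
IsMinimalSeparator {W} Adj U =
  Σ W λ a → Σ W λ b → ¬ Adj a b × MinimalSeparatorFor Adj U a b

ExactlyTwoComponents : {W : Set} → (W → W → Set) → (W → Set) → Set
ExactlyTwoComponents {W} Adj P =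
  Σ W λ c₁ → Σ W λ c₂ → P c₁ × P c₂ × ¬ Walk Adj P c₁ c₂ ×
  (∀ w → P w → Walk Adj P w c₁ ⊎ Walk Adj P w c₂)

-- Let F separate a from b minimally in LG(𝒫), and let A and B be the components of a and b in
-- LG(𝒫) − F.  Minimality makes every g ∈ F adjacent to both A and B (otherwise F − g would still
-- separate).  Call a vertex x of G(𝒫) covered if some edge of A ∪ B is incident with x.  Along an
-- edge g = xy of G(𝒫) coverage propagates: if g ∉ F then g shares x with the covering edge and so
-- lies in A ∪ B; if g ∈ F, its neighbours in A and in B cannot both sit at x, since two edges
-- sharing an endpoint are adjacent in LG(𝒫) and would join A to B.  As G(𝒫) is connected, every
-- vertex is covered, so every edge outside F meets an edge of A ∪ B and lies in A or in B.
-- Only connectedness and simplicity of G(𝒫) are used, not the tree structure of the profile.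
module Submission where

open import Defs
open import Data.Nat using (ℕ; zero; suc; _<_; s≤s⁻¹)
open import Data.Nat.Properties using (≤-refl; <-≤-trans)
open import Data.Fin using (Fin)
open import Data.Fin.Properties using (_<?_; <-cmp; <-irrelevant) renaming (_≟_ to _≟ᶠ_)
open import Data.Bool using (Bool; T; _∧_; _∨_; not)
open import Data.Bool.Properties using (T?; T-∧; T-∨; T-irrelevant)
open import Data.Bool.ListAction using (any)
open import Data.Unit using (⊤)
open import Data.Empty using (⊥; ⊥-elim)
open import Data.Product using (∃; Σ; _×_; _,_; proj₁; proj₂; uncurry)
open import Data.Sum using (_⊎_; inj₁; inj₂; swap) renaming (map to map⊎)
open import Data.List using (List; []; _∷_; length; allFin; concatMap; cartesianProduct; filter)
open import Data.List.Properties using (filter-notAll)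
open import Data.List.Relation.Unary.Any as Any using (here; any?; satisfied)
open import Data.List.Relation.Unary.Any.Properties using (any⁺; any⁻)
open import Data.List.Membership.Propositional using (_∈_; lose)
open import Data.List.Membership.Propositional.Properties
  using (∈-allFin; ∈-concatMap⁺; ∈-cartesianProduct⁺; ∈-filter⁺)
open import Function using (_∘_)
open import Function.Bundles using (module Equivalence)
open import Relation.Nullary using (¬_; Dec; yes; no; ¬?)
open import Relation.Nullary.Decidable
  using (⌊_⌋; toWitness; fromWitness; toWitnessFalse; _×-dec_; _⊎-dec_)
open import Relation.Binary.Definitions using (DecidableEquality; tri<; tri≈; tri>)
open import Relation.Binary.PropositionalEquality using (_≡_; refl; sym; trans; subst)

open Equivalence using (to; from)

module _ {V : Set} {Adj : V → V → Set} {P : V → Set} where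

  P-start : ∀ {u v} → Walk Adj P u v → P u
  P-start (stop Pu)     = Pu
  P-start (step Pu _ _) = Pu

  P-end : ∀ {u v} → Walk Adj P u v → P v
  P-end (stop Pv)    = Pv
  P-end (step _ _ w) = P-end w

  _++ʷ_ : ∀ {u v w} → Walk Adj P u v → Walk Adj P v w → Walk Adj P u w
  stop _       ++ʷ w′ = w′
  step Pu uv w ++ʷ w′ = step Pu uv (w ++ʷ w′)

  snocʷ : ∀ {u v w} → Walk Adj P u v → Adj v w → P w → Walk Adj P u w
  snocʷ w vw Pw = w ++ʷ step (P-end w) vw (stop Pw)

  reverseʷ : (∀ {x y} → Adj x y → Adj y x) → ∀ {u v} → Walk Adj P u v → Walk Adj P v u
  reverseʷ sym (stop Pu)      = stop Pu
  reverseʷ sym (step Pu uv w) = snocʷ (reverseʷ sym w) (sym uv) Pu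

module Reachability {V : Set} (Adj : V → V → Set) (P : V → Set)
  (Adj? : ∀ x y → Dec (Adj x y)) (P? : ∀ x → Dec (P x)) (_≟_ : DecidableEquality V)
  (vertices : List V) (∈-vertices : ∀ v → v ∈ vertices) where

  module _ (u : V) where

    Reaches : (V → Bool) → Set
    Reaches S = ∀ {z} → T (S z) → Walk Adj P u z

    Closed : (V → Bool) → Set
    Closed S = ∀ {x z} → T (S x) → Adj x z → P z → T (S z)

    record IsReachableSet (S : V → Bool) : Set where
      field
        ∋u      : T (S u)
        reached : Reaches S
        closed  : Closed S

    closed-under-walks : ∀ {S x v} → Closed S → T (S x) → Walk Adj P x v → T (S v)
    closed-under-walks closed Sx (stop _)      = Sx
    closed-under-walks closed Sx (step _ xy w) = closed-under-walks closed (closed Sx xy (P-start w)) w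

    grow : (V → Bool) → V → Bool
    grow S z = S z ∨ (⌊ P? z ⌋ ∧ any (λ x → S x ∧ ⌊ Adj? x z ⌋) vertices)

    ⊆-grow : ∀ S {z} → T (S z) → T (grow S z)
    ⊆-grow S {z} Sz = from (T-∨ {S z}) (inj₁ Sz)

    grow-closed : ∀ S {x z} → T (S x) → Adj x z → P z → T (grow S z)
    grow-closed S {x} {z} Sx xz Pz = from (T-∨ {S z}) (inj₂ (from (T-∧ {⌊ P? z ⌋}) (fromWitness Pz ,
      any⁺ _ (lose (∈-vertices x) (from (T-∧ {S x}) (Sx , fromWitness xz))))))

    grow-reached : ∀ S → Reaches S → Reaches (grow S)
    grow-reached S reached {z} Sz⁺ with to (T-∨ {S z}) Sz⁺
    ... | inj₁ Sz = reached Sz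
    ... | inj₂ Pz∧entry with to (T-∧ {⌊ P? z ⌋}) Pz∧entry
    ... | Pz , entry with satisfied (any⁻ _ vertices entry)
    ... | x , Sx∧xz with to (T-∧ {S x}) Sx∧xz
    ... | Sx , xz = snocʷ (reached Sx) (toWitness xz) (toWitness Pz)

    -- Terminates because pending covers the complement of S and loses all of grow S in each round.
    closure : ∀ n S (pending : List V) → length pending < n → T (S u)
            → Reaches S → (∀ z → T (S z) ⊎ z ∈ pending)
            → ∃ IsReachableSet
    closure zero    _ _ () _ _ _
    closure (suc n) S pending bound Su reached covered with any? (T? ∘ grow S) pending
    ... | no none = S , record { ∋u = Su ; reached = reached ; closed = closed }
      where
        closed : Closed S
        closed Sx xz Pz with covered _
        ... | inj₁ Sz = Sz
        ... | inj₂ z∈ = ⊥-elim (none (lose z∈ (grow-closed S Sx xz Pz)))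
    ... | yes some =
      closure n (grow S) pending′ shorter (⊆-grow S Su) (grow-reached S reached) covered′
      where
        pending′ : List V
        pending′ = filter (¬? ∘ T? ∘ grow S) pending

        shorter : length pending′ < n
        shorter = <-≤-trans (filter-notAll (¬? ∘ T? ∘ grow S) pending (Any.map (λ t ¬t → ¬t t) some))
                            (s≤s⁻¹ bound)

        covered′ : ∀ z → T (grow S z) ⊎ z ∈ pending′
        covered′ z with covered z | T? (grow S z)
        ... | inj₁ Sz | _      = inj₁ (⊆-grow S Sz)
        ... | inj₂ _  | yes Sz⁺ = inj₁ Sz⁺
        ... | inj₂ z∈ | no ¬Sz⁺ = inj₂ (∈-filter⁺ (¬? ∘ T? ∘ grow S) z∈ ¬Sz⁺)

    reachable? : ∀ v → Dec (Walk Adj P u v)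
    reachable? v with P? u
    ... | no ¬Pu = no (¬Pu ∘ P-start)
    ... | yes Pu with closure (suc (length vertices)) (λ z → ⌊ z ≟ u ⌋) vertices ≤-refl
                              (fromWitness refl) start (inj₂ ∘ ∈-vertices)
      where
        start : Reaches (λ z → ⌊ z ≟ u ⌋)
        start z≡u with toWitness z≡u
        ... | refl = stop Pu
    ... | S , component with T? (S v)
    ...   | yes Sv  = yes (IsReachableSet.reached component Sv)
    ...   | no ¬Sv  = no (¬Sv ∘ closed-under-walks (IsReachableSet.closed component)
                                                  (IsReachableSet.∋u component))

module MinimalSeparators {W : Set} (Adj : W → W → Set) (Adj-sym : ∀ {x y} → Adj x y → Adj y x)
  (Adj? : ∀ x y → Dec (Adj x y)) (_≟_ : DecidableEquality W)
  (vertices : List W) (∈-vertices : ∀ w → w ∈ vertices) where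

  Outside : (W → Bool) → W → Set
  Outside U w = ¬ T (U w)

  _without_ : (W → Bool) → W → W → Bool
  (U without g) w = U w ∧ not ⌊ w ≟ g ⌋

  without-⊆ : ∀ U {g} w → T ((U without g) w) → T (U w)
  without-⊆ U w = proj₁ ∘ to (T-∧ {U w})

  ∉-without : ∀ U g → Outside (U without g) g
  ∉-without U g = (λ g≢g → toWitnessFalse g≢g refl) ∘ proj₂ ∘ to (T-∧ {U g})

  outside-without : ∀ U {g y} → Outside (U without g) y → Outside U y ⊎ y ≡ g
  outside-without U {g} {y} y∉ with T? (U y) | y ≟ g
  ... | no y∉U  | _       = inj₁ y∉U
  ... | yes _   | yes y≡g = inj₂ y≡g
  ... | yes y∈U | no _    = ⊥-elim (y∉ (from (T-∧ {U y}) (y∈U , _)))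

  walk-until : ∀ U {g x t} → Walk Adj (Outside (U without g)) x t → Outside U x
             → Walk Adj (Outside U) x t ⊎ ∃ λ p → Walk Adj (Outside U) x p × Adj p g
  walk-until U (stop _) x∉U = inj₁ (stop x∉U)
  walk-until U (step _ xy w) x∉U with outside-without U (P-start w)
  ... | inj₂ refl = inj₂ (_ , stop x∉U , xy)
  ... | inj₁ y∉U with walk-until U w y∉U
  ...   | inj₁ w′              = inj₁ (step x∉U xy w′)
  ...   | inj₂ (p , w′ , p~g) = inj₂ (p , step x∉U xy w′ , p~g)

  minimal-separator-sym : ∀ {U a b} → MinimalSeparatorFor Adj U a b → MinimalSeparatorFor Adj U b a
  minimal-separator-sym ((a∉U , b∉U , ¬a⇝b) , minimal) =
    (b∉U , a∉U , ¬a⇝b ∘ reverseʷ Adj-sym) ,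
    λ U′ U′⊆U U′⊂U (b∉U′ , a∉U′ , ¬b⇝a) → minimal U′ U′⊆U U′⊂U (a∉U′ , b∉U′ , ¬b⇝a ∘ reverseʷ Adj-sym)

  -- Minimality only refutes that U − g separates a from b; deciding reachability turns this into
  -- a walk from a to b avoiding U − g, and the step before its first visit to g is the neighbour.
  minimal-separator-neighbour : ∀ {U a b g} → MinimalSeparatorFor Adj U a b → T (U g)
                              → ∃ λ p → Walk Adj (Outside U) a p × Adj p g
  minimal-separator-neighbour {U} {a} {b} {g} ((a∉U , b∉U , ¬a⇝b) , minimal) g∈U
    with Reachability.reachable? Adj (Outside (U without g)) Adj? (λ w → ¬? (T? ((U without g) w)))
                                 _≟_ vertices ∈-vertices a b
  ... | no ¬a⇝b′ = ⊥-elim (minimal (U without g) (without-⊆ U) (g , g∈U , ∉-without U g)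
                                   (a∉U ∘ without-⊆ U a , b∉U ∘ without-⊆ U b , ¬a⇝b′))
  ... | yes a⇝b′ with walk-until U a⇝b′ a∉U
  ...   | inj₁ a⇝b       = ⊥-elim (¬a⇝b a⇝b)
  ...   | inj₂ neighbour = neighbour

module _ {N k : ℕ} (𝒫 : Profile N k) where
  open Profile 𝒫

  private
    E : Set
    E = Edge 𝒫

    LG : E → E → Set
    LG = LGAdj 𝒫

  display-sym : ∀ {u v} → DisplayAdj 𝒫 u v → DisplayAdj 𝒫 v u
  display-sym {u} {v} uv =
    any⁺ _ (Any.map (λ {i} → IsTree.symmetric (isTree i) u v) (any⁻ _ (allFin k) uv))

  display-irrefl : ∀ {u} → ¬ DisplayAdj 𝒫 u u
  display-irrefl {u} uu with satisfied (any⁻ _ (allFin k) uu)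
  ... | i , uuᵢ = IsTree.irreflexive (isTree i) u uuᵢ

  edge-≡ : ∀ {e f : E} → lo e ≡ lo f → hi e ≡ hi f → e ≡ f
  edge-≡ {edge l h l<h lh} {edge .l .h l<h′ lh′} refl refl
    rewrite <-irrelevant l<h l<h′ | T-irrelevant lh lh′ = refl

  _≟ᴱ_ : DecidableEquality E
  e ≟ᴱ f with lo e ≟ᶠ lo f | hi e ≟ᶠ hi f
  ... | yes l≡ | yes h≡ = yes (edge-≡ l≡ h≡)
  ... | no l≢  | _      = no (l≢ ∘ cong-lo)
    where cong-lo : e ≡ f → lo e ≡ lo f
          cong-lo refl = refl
  ... | yes _  | no h≢  = no (h≢ ∘ cong-hi)
    where cong-hi : e ≡ f → hi e ≡ hi f
          cong-hi refl = refl

  candidates : Fin N → Fin N → List E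
  candidates i j with i <? j | T? (gadj 𝒫 i j)
  ... | yes i<j | yes ij = edge i j i<j ij ∷ []
  ... | _       | _      = []

  ∈-candidates : ∀ e → e ∈ candidates (lo e) (hi e)
  ∈-candidates e with lo e <? hi e | T? (gadj 𝒫 (lo e) (hi e))
  ... | yes _ | yes _  = here (edge-≡ refl refl)
  ... | no ≮  | _      = ⊥-elim (≮ (lo<hi e))
  ... | yes _ | no ¬lh = ⊥-elim (¬lh (isEdge e))

  edges : List E
  edges = concatMap (uncurry candidates) (cartesianProduct (allFin N) (allFin N))

  ∈-edges : ∀ e → e ∈ edges
  ∈-edges e = ∈-concatMap⁺ (uncurry candidates)
    (lose (∈-cartesianProduct⁺ (∈-allFin (lo e)) (∈-allFin (hi e))) (∈-candidates e))

  LG-sym : ∀ {e f} → LG e f → LG f e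
  LG-sym {e} {f} (e≢f , shared) = (λ (l≡ , h≡) → e≢f (sym l≡ , sym h≡)) , flip {e} {f} shared
    where
      flip : ∀ {e f : E} → lo e ≡ lo f ⊎ lo e ≡ hi f ⊎ hi e ≡ lo f ⊎ hi e ≡ hi f
           → lo f ≡ lo e ⊎ lo f ≡ hi e ⊎ hi f ≡ lo e ⊎ hi f ≡ hi e
      flip (inj₁ ll)               = inj₁ (sym ll)
      flip (inj₂ (inj₁ lh))        = inj₂ (inj₂ (inj₁ (sym lh)))
      flip (inj₂ (inj₂ (inj₁ hl))) = inj₂ (inj₁ (sym hl))
      flip (inj₂ (inj₂ (inj₂ hh))) = inj₂ (inj₂ (inj₂ (sym hh)))

  LG? : ∀ e f → Dec (LG e f)
  LG? e f = ¬? ((lo e ≟ᶠ lo f) ×-dec (hi e ≟ᶠ hi f)) ×-dec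
            ((lo e ≟ᶠ lo f) ⊎-dec (lo e ≟ᶠ hi f) ⊎-dec (hi e ≟ᶠ lo f) ⊎-dec (hi e ≟ᶠ hi f))

  data Incident (e : E) (x : Fin N) : Set where
    at-lo : lo e ≡ x → Incident e x
    at-hi : hi e ≡ x → Incident e x

  incident⇒≡⊎LG : ∀ {e f x} → Incident e x → Incident f x → e ≡ f ⊎ LG e f
  incident⇒≡⊎LG {e} {f} ex fx with e ≟ᴱ f
  ... | yes e≡f = inj₁ e≡f
  ... | no e≢f  = inj₂ ((λ (l≡ , h≡) → e≢f (edge-≡ l≡ h≡)) , shared {e} {f} ex fx)
    where
      shared : ∀ {e f : E} {x} → Incident e x → Incident f x
             → lo e ≡ lo f ⊎ lo e ≡ hi f ⊎ hi e ≡ lo f ⊎ hi e ≡ hi f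
      shared (at-lo l) (at-lo l′) = inj₁ (trans l (sym l′))
      shared (at-lo l) (at-hi h′) = inj₂ (inj₁ (trans l (sym h′)))
      shared (at-hi h) (at-lo l′) = inj₂ (inj₂ (inj₁ (trans h (sym l′))))
      shared (at-hi h) (at-hi h′) = inj₂ (inj₂ (inj₂ (trans h (sym h′))))

  LG⇒incident : ∀ {p} g → LG p g → Incident p (lo g) ⊎ Incident p (hi g)
  LG⇒incident _ (_ , inj₁ ll)               = inj₁ (at-lo ll)
  LG⇒incident _ (_ , inj₂ (inj₁ lh))        = inj₂ (at-lo lh)
  LG⇒incident _ (_ , inj₂ (inj₂ (inj₁ hl))) = inj₁ (at-hi hl)
  LG⇒incident _ (_ , inj₂ (inj₂ (inj₂ hh))) = inj₂ (at-hi hh)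

  display-edge : ∀ {x y} → DisplayAdj 𝒫 x y
               → Σ E λ g → Incident g x × Incident g y × (∀ {p} → LG p g → Incident p x ⊎ Incident p y)
  display-edge {x} {y} xy with <-cmp x y
  ... | tri< x<y _ _  = g , at-lo refl , at-hi refl , λ {p} → LG⇒incident {p} g
    where g = edge x y x<y xy
  ... | tri≈ _ refl _ = ⊥-elim (display-irrefl xy)
  ... | tri> _ _ y<x  = g , at-hi refl , at-lo refl , λ {p} → swap ∘ LG⇒incident {p} g
    where g = edge y x y<x (display-sym xy)

  open MinimalSeparators LG (λ {e f} → LG-sym {e} {f}) LG? _≟ᴱ_ edges ∈-edges

  module _ (connected : Connected (DisplayAdj 𝒫)) {F : E → Bool} {a b : E}
           (separator : MinimalSeparatorFor LG F a b) where

    private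
      _⇝_ : E → E → Set
      _⇝_ = Walk LG (Outside F)

      reverse⇝ : ∀ {e f} → e ⇝ f → f ⇝ e
      reverse⇝ = reverseʷ (λ {e f} → LG-sym {e} {f})

      a∉F : Outside F a
      a∉F = proj₁ (proj₁ separator)

      ¬a⇝b : ¬ a ⇝ b
      ¬a⇝b = proj₂ (proj₂ (proj₁ separator))

    Reached : E → Set
    Reached e = a ⇝ e ⊎ b ⇝ e

    Covered : Fin N → Set
    Covered x = Σ E λ e → Incident e x × Reached e

    reached-at-shared-vertex : ∀ {e f x} → Reached e → Incident e x → Incident f x → Outside F f
                             → Reached f
    reached-at-shared-vertex {e} {f} reached ex fx f∉F with incident⇒≡⊎LG ex fx
    ... | inj₁ e≡f = subst Reached e≡f reached
    ... | inj₂ e~f = map⊎ (λ w → snocʷ w e~f f∉F) (λ w → snocʷ w e~f f∉F) reached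

    components-apart : ∀ {p q x} → a ⇝ p → b ⇝ q → Incident p x → Incident q x → ⊥
    components-apart a⇝p b⇝q px qx with incident⇒≡⊎LG px qx
    ... | inj₁ p≡q = ¬a⇝b (subst (a ⇝_) p≡q a⇝p ++ʷ reverse⇝ b⇝q)
    ... | inj₂ p~q = ¬a⇝b (snocʷ a⇝p p~q (P-end b⇝q) ++ʷ reverse⇝ b⇝q)

    covered-step : ∀ {x y} → Covered x → DisplayAdj 𝒫 x y → Covered y
    covered-step (e , ex , reached) xy with display-edge xy
    ... | g , gx , gy , g-neighbours with T? (F g)
    ... | no g∉F = g , gy , reached-at-shared-vertex reached ex gx g∉F
    ... | yes g∈F
      with minimal-separator-neighbour {F} separator g∈F
         | minimal-separator-neighbour {F} (minimal-separator-sym {F} separator) g∈F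
    ... | p , a⇝p , p~g | q , b⇝q , q~g with g-neighbours p~g | g-neighbours q~g
    ...   | inj₂ py | _       = p , py , inj₁ a⇝p
    ...   | inj₁ _  | inj₂ qy = q , qy , inj₂ b⇝q
    ...   | inj₁ px | inj₁ qx = ⊥-elim (components-apart a⇝p b⇝q px qx)

    covered-walk : ∀ {x y} → Walk (DisplayAdj 𝒫) (λ _ → ⊤) x y → Covered x → Covered y
    covered-walk (stop _)      covered = covered
    covered-walk (step _ xy w) covered = covered-walk w (covered-step covered xy)

    minimal-separator-components : ∀ w → Outside F w → Walk LG (Outside F) w a ⊎ Walk LG (Outside F) w b
    minimal-separator-components w w∉F
      with covered-walk (connected (lo a) (lo w)) (a , at-lo refl , inj₁ (stop a∉F))
    ... | e , e-at-lo-w , reached =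
      map⊎ reverse⇝ reverse⇝
           (reached-at-shared-vertex reached e-at-lo-w (at-lo refl) w∉F)

lemma4 : ∀ {N k : ℕ} (𝒫 : Profile N k) → Connected (DisplayAdj 𝒫)
    → (F : Edge 𝒫 → Bool) → IsMinimalSeparator (LGAdj 𝒫) F
    → ExactlyTwoComponents (LGAdj 𝒫) (λ e → ¬ T (F e))
lemma4 𝒫 connected F (a , b , _ , separator@((a∉F , b∉F , ¬a⇝b) , _)) =
  a , b , a∉F , b∉F , ¬a⇝b , minimal-separator-components 𝒫 connected separator
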